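{- Let $G=(V,E)$ be a finite simple graph. Define the graph $G'=(V',E')$ by $V'_{\mathrm{man}}=\{i_m: i\in V\}$, $V'_{\mathrm{opt}}=\{i_o: i\in V\}$, $V'=V'_{\mathrm{man}}\cup V'_{\mathrm{opt}}$, and $E'=\{(i_m,j_m):(i,j)\in E\}\cup\{(i_m,j_o),(i_o,j_m):(i,j)\in E\}$. Let $M'\subseteq E'$ be any 2MO solution of $G'$ (with mandatory nodes $V'_{\mathrm{man}}$ and optional nodes $V'_{\mathrm{opt}}$), and let $M$ be the multiset of edges of $G$ obtained by adding one copy of the edge $\{i,j\}$ for each edge among $(i_m,j_m)$, $(i_o,j_m)$, $(i_m,j_o)$ that lies in $M'$. Then in $M$ every vertex of $V$ has degree 2 or 4, every edge of $E$ appears at most 3 times, and every connected component of $M$ has at least three vertices.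
   Context: A 2MO solution of a graph whose vertex set is partitioned into mandatory and optional nodes is a set of edges such that every mandatory node is incident to exactly 2 chosen edges and every optional node is incident to 0 or 2 chosen edges. -}

module Defs where

open import Data.Nat using (ℕ; _+_; _≤_; _<_)
open import Data.Bool using (Bool; true; false; if_then_else_)
open import Data.Fin using (Fin)
open import Data.List using (List; map; allFin; _++_)
open import Data.Nat.ListAction using (sum)
open import Data.Sum using (_⊎_)
open import Data.Product using (∃; _×_; _,_)
open import Relation.Binary.PropositionalEquality using (_≡_; _≢_)
open import Relation.Binary.Construct.Closure.ReflexiveTransitive using (Star)

record SimpleGraph (n : ℕ) : Set where
  field
    adj     : Fin n → Fin n → Bool
    adj-sym : ∀ i j → adj i j ≡ adj j i
    irrefl  : ∀ i → adj i i ≡ false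
open SimpleGraph public

b2n : Bool → ℕ
b2n true  = 1
b2n false = 0

data V′ (n : ℕ) : Set where
  man : Fin n → V′ n
  opt : Fin n → V′ n

allV′ : (n : ℕ) → List (V′ n)
allV′ n = map man (allFin n) ++ map opt (allFin n)

adj′ : ∀ {n} → SimpleGraph n → V′ n → V′ n → Bool
adj′ G (man i) (man j) = adj G i j
adj′ G (man i) (opt j) = adj G i j
adj′ G (opt i) (man j) = adj G i j
adj′ G (opt i) (opt j) = false

record EdgeSubset′ {n : ℕ} (G : SimpleGraph n) : Set where
  field
    sel     : V′ n → V′ n → Bool
    sel-sym : ∀ u v → sel u v ≡ sel v u
    sel-⊆   : ∀ u v → sel u v ≡ true → adj′ G u v ≡ true
open EdgeSubset′ public

deg′ : ∀ {n} {G : SimpleGraph n} → EdgeSubset′ G → V′ n → ℕ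
deg′ {n} M u = sum (map (λ v → b2n (sel M u v)) (allV′ n))

Is2MO : ∀ {n} {G : SimpleGraph n} → EdgeSubset′ G → Set
Is2MO {n} M =
  (∀ i → deg′ M (man i) ≡ 2) ×
  (∀ i → deg′ M (opt i) ≡ 0 ⊎ deg′ M (opt i) ≡ 2)

mult : ∀ {n} {G : SimpleGraph n} → EdgeSubset′ G → Fin n → Fin n → ℕ
mult M i j = b2n (sel M (man i) (man j)) + b2n (sel M (man i) (opt j))
             + b2n (sel M (opt i) (man j))

degM : ∀ {n} {G : SimpleGraph n} → EdgeSubset′ G → Fin n → ℕ
degM {n} M i = sum (map (λ j → mult M i j) (allFin n))

AdjM : ∀ {n} {G : SimpleGraph n} → EdgeSubset′ G → Fin n → Fin n → Set
AdjM M i j = 0 < mult M i j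

Conn : ∀ {n} {G : SimpleGraph n} → EdgeSubset′ G → Fin n → Fin n → Set
Conn M = Star (AdjM M)

ComponentAtLeast3 : ∀ {n} {G : SimpleGraph n} → EdgeSubset′ G → Fin n → Set
ComponentAtLeast3 {n} M i =
  ∃ λ (j : Fin n) → ∃ λ (k : Fin n) →
    Conn M i j × Conn M i k × i ≢ j × i ≢ k × j ≢ k

-- Since optional copies are never joined to each other, the degree of i in M
-- is deg(i_m) + deg(i_o) = 2 + (0 or 2), and each multiplicity counts at most
-- three edges of G'. Every vertex has a neighbour, and no vertex is adjacent to
-- itself. If some pair {i,j} had no M-neighbour outside itself, then i_m would
-- have to use both j_m and j_o, so j_o would be incident to the single chosen
-- edge {i_m,j_o}: degree 1, which a 2MO solution forbids. Hence every
-- component contains a third vertex.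
module Submission where

open import Defs
open import Data.Nat using (ℕ; _≤_)
open import Data.Fin using (Fin)
open import Data.Sum using (_⊎_)
open import Data.Product using (_×_)
open import Relation.Binary.PropositionalEquality using (_≡_)

open import Data.Bool using (true; false)
open import Data.Nat using (zero; suc; _+_; _<_; _<?_; z≤n; s≤s)
open import Data.Nat.Properties
  using (+-0-commutativeMonoid; +-identityʳ; +-mono-≤; n≤0⇒n≡0; ≮⇒≥; n≮0)
open import Data.Nat.ListAction using () renaming (sum to sumˡ)
open import Data.Nat.ListAction.Properties using (sum-++)
open import Data.Fin using (punchIn) renaming (zero to fzero; suc to fsuc)
open import Data.Fin.Properties using (_≟_; any?; punchInᵢ≢i)
open import Data.List using (map; tabulate; allFin; _++_)
open import Data.List.Properties using (map-++; map-∘; map-tabulate)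
open import Data.Product using (∃; _,_; proj₁; proj₂)
open import Data.Sum using (inj₁; inj₂; [_,_])
open import Data.Empty using (⊥-elim)
open import Function using (_∘_; id)
open import Relation.Nullary using (¬_; yes; no; ¬?; _×-dec_; _⊎-dec_)
open import Relation.Binary.PropositionalEquality
  using (refl; sym; trans; cong; cong₂; subst; _≢_; ≢-sym; module ≡-Reasoning)
open import Relation.Binary.Construct.Closure.ReflexiveTransitive using (ε; _◅_)
open import Algebra.Properties.CommutativeMonoid.Sum +-0-commutativeMonoid
  using (sum; sum-syntax; sum-cong-≗; sum-replicate-zero; sum-remove; ∑-distrib-+)

open ≡-Reasoning

sum-tabulate : ∀ {n} (f : Fin n → ℕ) → sumˡ (tabulate f) ≡ ∑[ j < n ] f j
sum-tabulate {zero}  f = refl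
sum-tabulate {suc n} f = cong (f fzero +_) (sum-tabulate (f ∘ fsuc))

sum-map-allFin : ∀ {n} (f : Fin n → ℕ) → sumˡ (map f (allFin n)) ≡ ∑[ j < n ] f j
sum-map-allFin f = trans (cong sumˡ (map-tabulate id f)) (sum-tabulate f)

∑-zero : ∀ {n} (f : Fin n → ℕ) → (∀ j → f j ≡ 0) → ∑[ j < n ] f j ≡ 0
∑-zero {n} f f≡0 = trans (sum-cong-≗ f≡0) (sum-replicate-zero n)

∑-supported-at : ∀ {n} (f : Fin n → ℕ) (a : Fin n) →
                 (∀ j → j ≢ a → f j ≡ 0) → ∑[ j < n ] f j ≡ f a
∑-supported-at {suc n} f a f≡0 = begin
  sum f                      ≡⟨ sum-remove f ⟩
  f a + sum (f ∘ punchIn a)  ≡⟨ cong (f a +_) (∑-zero _ (λ j → f≡0 _ (punchInᵢ≢i a j))) ⟩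
  f a + 0                    ≡⟨ +-identityʳ (f a) ⟩
  f a                        ∎

∑-positive⇒∃ : ∀ {n} (f : Fin n → ℕ) → 0 < ∑[ j < n ] f j → ∃ λ j → 0 < f j
∑-positive⇒∃ {suc n} f ∑>0 with 0 <? f fzero
... | yes f₀>0 = fzero , f₀>0
... | no  f₀≯0 =
  let j , fj>0 = ∑-positive⇒∃ (f ∘ fsuc) (subst (λ x → 0 < x + sum (f ∘ fsuc)) (n≤0⇒n≡0 (≮⇒≥ f₀≯0)) ∑>0)
  in fsuc j , fj>0

b2n≤1 : ∀ b → b2n b ≤ 1
b2n≤1 true  = s≤s z≤n
b2n≤1 false = z≤n

b2n-sum≡0 : ∀ a b c → b2n a + b2n b + b2n c ≡ 0 → a ≡ false × b ≡ false × c ≡ false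
b2n-sum≡0 false false false _ = refl , refl , refl
b2n-sum≡0 true  _     _     ()
b2n-sum≡0 false true  _     ()
b2n-sum≡0 false false true  ()

b2n-sum≡2 : ∀ a b → b2n a + b2n b ≡ 2 → a ≡ true × b ≡ true
b2n-sum≡2 true  true  _ = refl , refl
b2n-sum≡2 true  false ()
b2n-sum≡2 false true  ()
b2n-sum≡2 false false ()

module _ {n : ℕ} {G : SimpleGraph n} (M : EdgeSubset′ G) where

  sel-non-edge : ∀ {u v} → adj′ G u v ≡ false → sel M u v ≡ false
  sel-non-edge {u} {v} non-edge with sel M u v in chosen
  ... | false = refl
  ... | true  with trans (sym (sel-⊆ M u v chosen)) non-edge
  ...            | ()

  deg′-split : ∀ u → deg′ M u ≡ ∑[ j < n ] b2n (sel M u (man j)) + ∑[ j < n ] b2n (sel M u (opt j))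
  deg′-split u = begin
    sumˡ (map h (map man all ++ map opt all))             ≡⟨ cong sumˡ (map-++ h (map man all) _) ⟩
    sumˡ (map h (map man all) ++ map h (map opt all))     ≡⟨ sum-++ (map h (map man all)) _ ⟩
    sumˡ (map h (map man all)) + sumˡ (map h (map opt all)) ≡⟨ cong₂ _+_ (over man) (over opt) ⟩
    ∑[ j < n ] h (man j) + ∑[ j < n ] h (opt j)           ∎
    where
    all = allFin n
    h = λ v → b2n (sel M u v)
    over : (c : Fin n → V′ n) → sumˡ (map h (map c all)) ≡ ∑[ j < n ] h (c j)
    over c = trans (cong sumˡ (sym (map-∘ all))) (sum-map-allFin (h ∘ c))

  deg′-opt : ∀ i → deg′ M (opt i) ≡ ∑[ j < n ] b2n (sel M (opt i) (man j))
  deg′-opt i = begin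
    deg′ M (opt i)                                 ≡⟨ deg′-split (opt i) ⟩
    ∑[ j < n ] b2n (sel M (opt i) (man j)) + ∑[ j < n ] b2n (sel M (opt i) (opt j))
      ≡⟨ cong (∑[ j < n ] b2n (sel M (opt i) (man j)) +_)
           (∑-zero _ (λ j → cong b2n (sel-non-edge {opt i} {opt j} refl))) ⟩
    ∑[ j < n ] b2n (sel M (opt i) (man j)) + 0   ≡⟨ +-identityʳ _ ⟩
    ∑[ j < n ] b2n (sel M (opt i) (man j))       ∎

  degM-split : ∀ i → degM M i ≡ deg′ M (man i) + deg′ M (opt i)
  degM-split i = begin
    degM M i                                       ≡⟨ sum-map-allFin (mult M i) ⟩
    ∑[ j < n ] (mm j + mo j + om j)                ≡⟨ ∑-distrib-+ (λ j → mm j + mo j) om ⟩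
    ∑[ j < n ] (mm j + mo j) + ∑[ j < n ] om j     ≡⟨ cong (_+ sum om) (∑-distrib-+ mm mo) ⟩
    ∑[ j < n ] mm j + ∑[ j < n ] mo j + ∑[ j < n ] om j
      ≡⟨ cong₂ _+_ (sym (deg′-split (man i))) (sym (deg′-opt i)) ⟩
    deg′ M (man i) + deg′ M (opt i)                ∎
    where
    mm = λ j → b2n (sel M (man i) (man j))
    mo = λ j → b2n (sel M (man i) (opt j))
    om = λ j → b2n (sel M (opt i) (man j))

  mult≤3 : ∀ i j → mult M i j ≤ 3
  mult≤3 i j = +-mono-≤ (+-mono-≤ (b2n≤1 (sel M (man i) (man j))) (b2n≤1 (sel M (man i) (opt j))))
                        (b2n≤1 (sel M (opt i) (man j)))

  mult-diagonal : ∀ i → mult M i i ≡ 0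
  mult-diagonal i
    rewrite sel-non-edge {man i} {man i} (irrefl G i)
          | sel-non-edge {man i} {opt i} (irrefl G i)
          | sel-non-edge {opt i} {man i} (irrefl G i) = refl

  AdjM-irrefl : ∀ {i j} → AdjM M i j → i ≢ j
  AdjM-irrefl {i} i~i refl = n≮0 (subst (0 <_) (mult-diagonal i) i~i)

  ¬AdjM⇒¬sel : ∀ {i k} → ¬ AdjM M i k →
    sel M (man i) (man k) ≡ false × sel M (man i) (opt k) ≡ false × sel M (opt i) (man k) ≡ false
  ¬AdjM⇒¬sel ¬i~k = b2n-sum≡0 _ _ _ (n≤0⇒n≡0 (≮⇒≥ ¬i~k))

module _ {n : ℕ} {G : SimpleGraph n} (M : EdgeSubset′ G) (solution : Is2MO M) where

  private
    deg-man = proj₁ solution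
    deg-opt = proj₂ solution

  degM-2-or-4 : ∀ i → degM M i ≡ 2 ⊎ degM M i ≡ 4
  degM-2-or-4 i = [ inj₁ ∘ degM≡2+ , inj₂ ∘ degM≡2+ ] (deg-opt i)
    where
    degM≡2+ : ∀ {d} → deg′ M (opt i) ≡ d → degM M i ≡ 2 + d
    degM≡2+ deg-i_o = trans (degM-split M i) (cong₂ _+_ (deg-man i) deg-i_o)

  ∃-neighbour : ∀ i → ∃ (AdjM M i)
  ∃-neighbour i = ∑-positive⇒∃ (mult M i) (subst (0 <_) degM≡2+ (s≤s z≤n))
    where
    degM≡2+ : 2 + deg′ M (opt i) ≡ ∑[ j < n ] mult M i j
    degM≡2+ = trans (sym (cong (_+ deg′ M (opt i)) (deg-man i)))
                    (trans (sym (degM-split M i)) (sum-map-allFin (mult M i)))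

  no-closed-pair : ∀ i j → ¬ (∀ k → k ≢ i → k ≢ j → ¬ AdjM M i k × ¬ AdjM M j k)
  no-closed-pair i j closed = [ (λ ()) ∘ trans (sym deg-j_o≡1) , (λ ()) ∘ trans (sym deg-j_o≡1) ] (deg-opt j)
    where
    i_m-only-to-j : ∀ k → k ≢ j → sel M (man i) (man k) ≡ false × sel M (man i) (opt k) ≡ false
    i_m-only-to-j k k≢j with k ≟ i
    ... | yes refl = sel-non-edge M (irrefl G k) , sel-non-edge M (irrefl G k)
    ... | no  k≢i  = let mm , mo , _ = ¬AdjM⇒¬sel M (proj₁ (closed k k≢i k≢j)) in mm , mo

    j_o-only-to-i : ∀ k → k ≢ i → sel M (opt j) (man k) ≡ false
    j_o-only-to-i k k≢i with k ≟ j
    ... | yes refl = sel-non-edge M (irrefl G k)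
    ... | no  k≢j  = proj₂ (proj₂ (¬AdjM⇒¬sel M (proj₂ (closed k k≢i k≢j))))

    i_m-j_o : sel M (man i) (opt j) ≡ true
    i_m-j_o = proj₂ (b2n-sum≡2 _ _ (begin
      b2n (sel M (man i) (man j)) + b2n (sel M (man i) (opt j))
        ≡⟨ sym (cong₂ _+_
             (∑-supported-at _ j (λ k k≢j → cong b2n (proj₁ (i_m-only-to-j k k≢j))))
             (∑-supported-at _ j (λ k k≢j → cong b2n (proj₂ (i_m-only-to-j k k≢j))))) ⟩
      ∑[ k < n ] b2n (sel M (man i) (man k)) + ∑[ k < n ] b2n (sel M (man i) (opt k))
        ≡⟨ sym (deg′-split M (man i)) ⟩
      deg′ M (man i)
        ≡⟨ deg-man i ⟩
      2 ∎))

    deg-j_o≡1 : deg′ M (opt j) ≡ 1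
    deg-j_o≡1 = begin
      deg′ M (opt j)                             ≡⟨ deg′-opt M j ⟩
      ∑[ k < n ] b2n (sel M (opt j) (man k))     ≡⟨ ∑-supported-at _ i (λ k k≢i → cong b2n (j_o-only-to-i k k≢i)) ⟩
      b2n (sel M (opt j) (man i))                ≡⟨ cong b2n (trans (sel-sym M (opt j) (man i)) i_m-j_o) ⟩
      1                                          ∎

  ∃-vertex-beyond-pair : ∀ i j → ∃ λ k → k ≢ i × k ≢ j × (AdjM M i k ⊎ AdjM M j k)
  ∃-vertex-beyond-pair i j
    with any? (λ k → ¬? (k ≟ i) ×-dec ¬? (k ≟ j) ×-dec (0 <? mult M i k ⊎-dec 0 <? mult M j k))
  ... | yes beyond = beyond
  ... | no  ¬beyond = ⊥-elim (no-closed-pair i j λ k k≢i k≢j →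
          (λ i~k → ¬beyond (k , k≢i , k≢j , inj₁ i~k)) ,
          (λ j~k → ¬beyond (k , k≢i , k≢j , inj₂ j~k)))

  component-≥3 : ∀ i → ComponentAtLeast3 M i
  component-≥3 i with ∃-neighbour i
  ... | j , i~j with ∃-vertex-beyond-pair i j
  ... | k , k≢i , k≢j , inj₁ i~k =
    j , k , i~j ◅ ε , i~k ◅ ε , AdjM-irrefl M i~j , ≢-sym k≢i , ≢-sym k≢j
  ... | k , k≢i , k≢j , inj₂ j~k =
    j , k , i~j ◅ ε , i~j ◅ j~k ◅ ε , AdjM-irrefl M i~j , ≢-sym k≢i , ≢-sym k≢j

lemma7 : ∀ (n : ℕ) (G : SimpleGraph n) (M : EdgeSubset′ G) → Is2MO M →
    (∀ (i : Fin n) → degM M i ≡ 2 ⊎ degM M i ≡ 4)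
    × (∀ (i j : Fin n) → mult M i j ≤ 3)
    × (∀ (i : Fin n) → ComponentAtLeast3 M i)
lemma7 n G M solution = degM-2-or-4 M solution , mult≤3 M , component-≥3 M solution
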